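{- Let $A$ be a setoid, $B$ a setoid family over $A$, $(C,a_C)$ a $P_B$-algebra and $h:W\Rightarrow C$ an algebra morphism, i.e. $h\circ\mathsf{s}\approx a_C\circ(P_B\,h)$. Then for every $w:W$ the restriction $h|_w:=h\circ m_w:\mathsf{ImS}\,w\Rightarrow C$ is recursively defined, i.e. $\mathsf{RecDef}\,w\,(h\circ m_w)$ is inhabited.
   Context: Setting: intensional Martin-Löf type theory with $\Pi$-types and a universe $\mathsf{U}$ closed under $\Pi$ and containing intensional $\Sigma$-types, identity types, the unit type, W-types and dependent W-types (inductive families); logic is propositions-as-types. A setoid $X$ is a tuple $(X_0,\approx_X,r_X,s_X,t_X)$ with $X_0:\mathsf{U}$, $\approx_X:X_0\to X_0\to\mathsf{U}$ and witnesses of reflexivity, symmetry, transitivity; $x:X$ means $x:X_0$. An extensional function $f:X\Rightarrow Y$ is $f_0:X_0\to Y_0$ with a proof of $\prod_{x,x'}x\approx x'\to f_0x\approx f_0x'$; the setoid $X\Rightarrow Y$ has $f\approx g:=\prod_x f_0x\approx g_0x$. A setoid family $B$ over a setoid $A$ gives a setoid $B\,a$ (underlying type $B_0a$) for $a:A$ and extensional transports $B_\alpha:B\,a\Rightarrow B\,a'$ for $\alpha:a\approx_Aa'$, functorial up to $\approx$, with $B_\alpha\approx B_{\alpha'}$ for all $\alpha,\alpha':a\approx a'$. Write $b\approx_\alpha b'$ for $B_\alpha b\approx b'$. $P_BX$ is the setoid on $\sum_{a:A_0}(B\,a\Rightarrow X)$ with $(a,k)\approx(a',k'):=\sum_{\alpha:a\approx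 a'}k\approx k'\circ B_\alpha$, and $P_Bf(a,k):=(a,f\circ k)$. A $P_B$-algebra is a setoid $C$ with extensional $a_C:P_BC\Rightarrow C$. $\mathrm{W}$ is the W-type on $A_0,B_0$ with constructor $\mathsf{sup}$, and $\mathsf{n}(\mathsf{sup}\,a\,f)\equiv a$, $\mathsf{b}(\mathsf{sup}\,a\,f)\equiv f$. $\mathcal{W}_B$ is the inductive family on $\mathrm{W}\times\mathrm{W}$ with single constructor $\mathsf{dsup}\,(w,w')\,\alpha\,\phi:\mathcal{W}_B\,w\,w'$ for $\alpha:\mathsf{n}w\approx_A\mathsf{n}w'$ and $\phi:\prod_{(b,b',\beta):\sum_{b,b'}b\approx_\alpha b'}\mathcal{W}_B(\mathsf{b}\,w\,b)(\mathsf{b}\,w'\,b')$. The setoid $W$ has underlying type $\sum_w\mathcal{W}_B\,w\,w$ and $(w,\_)\approx_W(w',\_):=\mathcal{W}_B\,w\,w'$. For $\gamma:w\approx_Ww'$, $\mathsf{n}\triangleright\gamma:\mathsf{n}w\approx_A\mathsf{n}w'$ is its label component; each $\mathsf{b}\,w:B(\mathsf{n}w)\Rightarrow W$ is extensional. $\mathsf{s}:P_BW\Rightarrow W$ sends $(a,f)$ to the tree $\mathsf{sup}\,a\,(\lambda b.\mathrm{pr}_1(f_0b))$ (with a proof that it lies in $W$). For $w:W$, $\mathsf{ImS}\,w$ is the setoid on $B_0(\mathsf{n}w)$ with $s\approx s':=\mathsf{b}\,w\,s\approx_W\mathsf{b}\,w\,s'$; for $\gamma:w\approx_Ww'$, $\mathsf{ImS}_\gamma:=B_{\mathsf{n}\triangleright\gamma}$.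 $e_w:B(\mathsf{n}w)\Rightarrow\mathsf{ImS}\,w$ is the identity on underlying types and $m_w:\mathsf{ImS}\,w\Rightarrow W$ has underlying function $\mathsf{b}\,w$. $\mathsf{CohMaps}\,w$ is the setoid of families $F:\prod_{s:\mathsf{ImS}\,w}\mathsf{ImS}(\mathsf{b}\,w\,s)\Rightarrow C$ such that $F\,s\approx(F\,s')\circ\mathsf{ImS}_\sigma$ for all $\sigma:\mathsf{b}\,w\,s\approx_W\mathsf{b}\,w\,s'$. For $F:\mathsf{CohMaps}\,w$, $\mathsf{recst}\,w\,F:\mathsf{ImS}\,w\Rightarrow C$ is $s\mapsto a_C(\mathsf{n}(\mathsf{b}\,w\,s),(F\,s)\circ e_{\mathsf{b}ws})$. For $k:\mathsf{ImS}\,w\Rightarrow C$, $\mathsf{RecDef}\,w\,k$ is the inductive family (dependent W-type indexed by $\sum_{w:W}(\mathsf{ImS}\,w\Rightarrow C)$) with the single constructor: from $F:\mathsf{CohMaps}\,w$, a proof of $k\approx\mathsf{recst}\,w\,F$ and $\prod_{s:B_0(\mathsf{n}w)}\mathsf{RecDef}\,(\mathsf{b}\,w\,s)\,(F\,s)$, form an element of $\mathsf{RecDef}\,w\,k$. -}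

module Defs where

open import Level using (0ℓ)
open import Data.Product using (Σ; _,_; proj₁; proj₂)
open import Relation.Binary.Bundles using (Setoid)
open import Function.Bundles using (Func; _⟨$⟩_)
import Function.Construct.Composition as Comp
import Function.Construct.Identity as Ident
import Function.Relation.Binary.Setoid.Equality as FEq

_⇒ₛ_ : Setoid 0ℓ 0ℓ → Setoid 0ℓ 0ℓ → Set
X ⇒ₛ Y = Func X Y

infixr 9 _∘ₛ_
_∘ₛ_ : {X Y Z : Setoid 0ℓ 0ℓ} → Func Y Z → Func X Y → Func X Z
g ∘ₛ f = Comp.function f g

idₛ : (X : Setoid 0ℓ 0ℓ) → Func X X
idₛ X = Ident.function X

_≈ₛ_ : {X Y : Setoid 0ℓ 0ℓ} → Func X Y → Func X Y → Set
_≈ₛ_ {X} {Y} f g = FEq._≈_ X Y f g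

record SetoidFamily (A : Setoid 0ℓ 0ℓ) : Set₁ where
  open Setoid A renaming (Carrier to A₀; _≈_ to _≈A_)
  field
    Fam   : A₀ → Setoid 0ℓ 0ℓ
    tr    : {a a' : A₀} → a ≈A a' → Func (Fam a) (Fam a')
    tr-refl  : {a : A₀} → tr (refl {a}) ≈ₛ idₛ (Fam a)
    tr-trans : {a a' a'' : A₀} (α : a ≈A a') (β : a' ≈A a'') →
               tr (trans α β) ≈ₛ (tr β ∘ₛ tr α)
    tr-irr   : {a a' : A₀} (α α' : a ≈A a') → tr α ≈ₛ tr α'

module Construction (A : Setoid 0ℓ 0ℓ) (B : SetoidFamily A) where

  open Setoid A public using () renaming (Carrier to A₀; _≈_ to _≈A_)
  module A = Setoid A
  open SetoidFamily B

  B₀ : A₀ → Set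
  B₀ a = Setoid.Carrier (Fam a)

  _≈[_]_ : {a a' : A₀} → B₀ a → a ≈A a' → B₀ a' → Set
  _≈[_]_ {a' = a'} b α b' = Setoid._≈_ (Fam a') (tr α ⟨$⟩ b) b'

  tr-loop : {a : A₀} (α : a ≈A a) (b : B₀ a) → Setoid._≈_ (Fam a) (tr α ⟨$⟩ b) b
  tr-loop {a} α b = Setoid.trans (Fam a) (tr-irr α A.refl b) (tr-refl b)

  tr-sym-inv : {a a' : A₀} (α : a ≈A a') (b : B₀ a') →
               Setoid._≈_ (Fam a') (tr α ⟨$⟩ (tr (A.sym α) ⟨$⟩ b)) b
  tr-sym-inv {a} {a'} α b =
    Setoid.trans (Fam a') (Setoid.sym (Fam a') (tr-trans (A.sym α) α b))
                          (tr-loop (A.trans (A.sym α) α) b)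

  module _ (X : Setoid 0ℓ 0ℓ) where
    private module X = Setoid X

    PRel : Σ A₀ (λ a → Func (Fam a) X) → Σ A₀ (λ a → Func (Fam a) X) → Set
    PRel (a , k) (a' , k') = Σ (a ≈A a') (λ α → k ≈ₛ (k' ∘ₛ tr α))

    P-refl : ∀ {x} → PRel x x
    P-refl {a , k} = A.refl , λ b → Func.cong k (Setoid.sym (Fam a) (tr-refl b))

    P-sym : ∀ {x y} → PRel x y → PRel y x
    P-sym {a , k} {a' , k'} (α , e) =
      A.sym α , λ b → X.trans (Func.cong k' (Setoid.sym (Fam a') (tr-sym-inv α b)))
                              (X.sym (e (tr (A.sym α) ⟨$⟩ b)))

    P-trans : ∀ {x y z} → PRel x y → PRel y z → PRel x z
    P-trans {a , k} {a' , k'} {a'' , k''} (α , e) (β , f) =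
      A.trans α β , λ b → X.trans (e b)
        (X.trans (f (tr α ⟨$⟩ b))
                 (Func.cong k'' (Setoid.sym (Fam a'') (tr-trans α β b))))

    P : Setoid 0ℓ 0ℓ
    P = record
      { Carrier = Σ A₀ (λ a → Func (Fam a) X)
      ; _≈_ = PRel
      ; isEquivalence = record
        { refl = λ {x} → P-refl {x}
        ; sym = λ {x} {y} → P-sym {x} {y}
        ; trans = λ {x} {y} {z} → P-trans {x} {y} {z} }
      }

  Pmap : {X Y : Setoid 0ℓ 0ℓ} → Func X Y → Func (P X) (P Y)
  Pmap f = record
    { to = λ { (a , k) → a , (f ∘ₛ k) }
    ; cong = λ { (α , e) → α , (λ b → Func.cong f (e b)) }
    }

  data 𝕎 : Set where
    sup : (a : A₀) → (B₀ a → 𝕎) → 𝕎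

  n : 𝕎 → A₀
  n (sup a f) = a

  b : (w : 𝕎) → B₀ (n w) → 𝕎
  b (sup a f) = f

  data 𝒲 : 𝕎 → 𝕎 → Set where
    dsup : (w w' : 𝕎) (α : n w ≈A n w') →
           ((x : Σ (B₀ (n w)) (λ c → Σ (B₀ (n w')) (λ c' → c ≈[ α ] c'))) →
              𝒲 (b w (proj₁ x)) (b w' (proj₁ (proj₂ x)))) →
           𝒲 w w'

  n▹ : {w w' : 𝕎} → 𝒲 w w' → n w ≈A n w'
  n▹ (dsup _ _ α _) = α

  sub : {w w' : 𝕎} (γ : 𝒲 w w') (c : B₀ (n w)) (c' : B₀ (n w')) →
        c ≈[ n▹ γ ] c' → 𝒲 (b w c) (b w' c')
  sub (dsup _ _ α φ) c c' β = φ (c , c' , β)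

  𝒲-sym : {w w' : 𝕎} → 𝒲 w w' → 𝒲 w' w
  𝒲-sym (dsup w w' α φ) = dsup w' w (A.sym α) λ { (c' , c , β) →
    𝒲-sym (φ (c , c' ,
      Setoid.trans (Fam (n w')) (Func.cong (tr α) (Setoid.sym (Fam (n w)) β))
                                (tr-sym-inv α c'))) }

  𝒲-trans : {w w' w'' : 𝕎} → 𝒲 w w' → 𝒲 w' w'' → 𝒲 w w''
  𝒲-trans (dsup w w' α φ) (dsup .w' w'' β ψ) = dsup w w'' (A.trans α β)
    λ { (c , c'' , γ) →
      𝒲-trans (φ (c , tr α ⟨$⟩ c , Setoid.refl (Fam (n w'))))
              (ψ (tr α ⟨$⟩ c , c'' ,
                 Setoid.trans (Fam (n w'')) (Setoid.sym (Fam (n w'')) (tr-trans α β c)) γ)) }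

  W : Setoid 0ℓ 0ℓ
  W = record
    { Carrier = Σ 𝕎 (λ w → 𝒲 w w)
    ; _≈_ = λ x y → 𝒲 (proj₁ x) (proj₁ y)
    ; isEquivalence = record
        { refl = λ {x} → proj₂ x
        ; sym = 𝒲-sym
        ; trans = 𝒲-trans
        }
    }

  W₀ : Set
  W₀ = Setoid.Carrier W

  _≈W_ : W₀ → W₀ → Set
  _≈W_ = Setoid._≈_ W

  nW : W₀ → A₀
  nW w = n (proj₁ w)

  bW₀ : (w : W₀) → B₀ (nW w) → W₀
  bW₀ (w , p) c = b w c , sub p c c (tr-loop (n▹ p) c)

  bW-cong : (w : W₀) {c c' : B₀ (nW w)} → Setoid._≈_ (Fam (nW w)) c c' →
            bW₀ w c ≈W bW₀ w c'
  bW-cong (w , p) {c} {c'} e =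
    sub p c c' (Setoid.trans (Fam (n w)) (tr-loop (n▹ p) c) e)

  bW : (w : W₀) → Func (Fam (nW w)) W
  bW w = record { to = bW₀ w ; cong = bW-cong w }

  s₀ : Setoid.Carrier (P W) → W₀
  s₀ (a , f) = sup a (λ c → proj₁ (f ⟨$⟩ c)) ,
    dsup _ _ A.refl (λ { (c , c' , β) →
      Func.cong f (Setoid.trans (Fam a) (Setoid.sym (Fam a) (tr-refl c)) β) })

  s : Func (P W) W
  s = record
    { to = s₀
    ; cong = λ { {a , f} {a' , f'} (α , e) → dsup _ _ α (λ { (c , c' , β) →
        𝒲-trans (e c) (Func.cong f' β) }) }
    }

  ImS : W₀ → Setoid 0ℓ 0ℓ
  ImS w = record
    { Carrier = B₀ (nW w)
    ; _≈_ = λ c c' → bW₀ w c ≈W bW₀ w c'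
    ; isEquivalence = record
        { refl = λ {c} → proj₂ (bW₀ w c)
        ; sym = 𝒲-sym
        ; trans = 𝒲-trans
        }
    }

  ImS-tr : (w w' : W₀) → w ≈W w' → Func (ImS w) (ImS w')
  ImS-tr (w , p) (w' , p') γ = record
    { to = λ c → tr (n▹ γ) ⟨$⟩ c
    ; cong = λ {c} {c'} e →
        𝒲-trans (𝒲-trans (𝒲-sym (lemma c)) e) (lemma c')
    }
    where
    lemma : (c : B₀ (n w)) → bW₀ (w , p) c ≈W bW₀ (w' , p') (tr (n▹ γ) ⟨$⟩ c)
    lemma c = sub γ c (tr (n▹ γ) ⟨$⟩ c) (Setoid.refl (Fam (n w')))

  e : (w : W₀) → Func (Fam (nW w)) (ImS w)
  e w = record { to = λ c → c ; cong = bW-cong w }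

  m : (w : W₀) → Func (ImS w) W
  m w = record { to = bW₀ w ; cong = λ x → x }

  module _ (C : Setoid 0ℓ 0ℓ) (aC : Func (P C) C) where

    record CohMaps (w : W₀) : Set where
      constructor cohMaps
      field
        fam : (c : B₀ (nW w)) → Func (ImS (bW₀ w c)) C
        coh : (c c' : B₀ (nW w)) (σ : bW₀ w c ≈W bW₀ w c') →
              fam c ≈ₛ (fam c' ∘ₛ ImS-tr (bW₀ w c) (bW₀ w c') σ)
    open CohMaps public

    recst : (w : W₀) → CohMaps w → Func (ImS w) C
    recst w F = record
      { to = λ c → aC ⟨$⟩ (nW (bW₀ w c) , (fam F c ∘ₛ e (bW₀ w c)))
      ; cong = λ {c} {c'} σ →
          Func.cong aC {nW (bW₀ w c) , (fam F c ∘ₛ e (bW₀ w c))}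
                       {nW (bW₀ w c') , (fam F c' ∘ₛ e (bW₀ w c'))}
                       (n▹ σ , coh F c c' σ)
      }

    data RecDef : (w : W₀) → Func (ImS w) C → Set where
      recDef : {w : W₀} {k : Func (ImS w) C} (F : CohMaps w) →
               k ≈ₛ recst w F →
               ((c : B₀ (nW w)) → RecDef (bW₀ w c) (fam F c)) →
               RecDef w k

module Submission where

-- The argument has three ingredients.
--  * η-law: every element v of W is ≈ to the tree  s (n v , b v)  built
--    from its own label and immediate subtrees.
--  * Naturality of m: a proof γ : v ≈ v' relates  m v  and  m v' ∘ ImS_γ.
--    Consequently, for ANY extensional h : W ⇒ C the restrictions
--    h ∘ m (b w c) of h to the immediate subtrees of w form a coherent
--    family, i.e. an element of CohMaps w.
--  * Recursion: if h satisfies the unfolding equation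
--    h ∘ m w ≈ recst w (restrictions of h below w) for every w, then by
--    structural induction on the underlying tree every h ∘ m w is
--    recursively defined.
-- The theorem follows because, by the η-law, an algebra morphism satisfies
-- the unfolding equation.

open import Defs
open import Level using (0ℓ)
open import Relation.Binary.Bundles using (Setoid)
open import Function.Bundles using (Func; _⟨$⟩_)
open import Data.Product using (_,_; proj₂)

module TreeFacts (A : Setoid 0ℓ 0ℓ) (B : SetoidFamily A) where
  open Construction A B
  open SetoidFamily B

  -- η-law: v ≈ s (n v , b v).  The tree underlying s (n v , b v) is
  -- literally the one underlying v, so v's own reflexivity proof serves.
  W-η : (v : W₀) → v ≈W (s ⟨$⟩ (nW v , bW v))
  W-η (sup a f , p) = p

  m-natural : (v v' : W₀) (γ : v ≈W v') (x : B₀ (nW v)) →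
              (m v ⟨$⟩ x) ≈W (m v' ⟨$⟩ (ImS-tr v v' γ ⟨$⟩ x))
  m-natural v v' γ x = sub γ x (tr (n▹ γ) ⟨$⟩ x) (Setoid.refl (Fam (nW v')))

module Restrictions (A : Setoid 0ℓ 0ℓ) (B : SetoidFamily A)
    (C : Setoid 0ℓ 0ℓ) (aC : Func (Construction.P A B C) C)
    (h : Func (Construction.W A B) C) where
  open Construction A B
  open TreeFacts A B

  restrictions : (w : W₀) → CohMaps C aC w
  restrictions w = cohMaps (λ c → h ∘ₛ m (bW₀ w c))
    (λ c c' σ x → Func.cong h (m-natural (bW₀ w c) (bW₀ w c') σ x))

  Unfolds : Set
  Unfolds = (w : W₀) → (h ∘ₛ m w) ≈ₛ recst C aC w (restrictions w)

  unfolding⇒recDef : Unfolds → (w : W₀) → RecDef C aC w (h ∘ₛ m w)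
  unfolding⇒recDef unfolds (w , p) = go w p
    where
    go : (t : 𝕎) (q : 𝒲 t t) → RecDef C aC (t , q) (h ∘ₛ m (t , q))
    go (sup a f) q = recDef (restrictions (sup a f , q)) (unfolds (sup a f , q))
      (λ c → go (f c) (proj₂ (bW₀ (sup a f , q) c)))

  -- An algebra morphism unfolds: for the subtree v at position c,
  --   h v ≈ h (s (n v , b v)) ≈ a_C (n v , h ∘ b v) = a_C (n v , (h ∘ m v) ∘ e v),
  -- the last step because  b v  and  m v ∘ e v  agree definitionally.
  morphism⇒unfolds : (h ∘ₛ s) ≈ₛ (aC ∘ₛ Pmap h) → Unfolds
  morphism⇒unfolds hom w c = begin
    h ⟨$⟩ v                            ≈⟨ Func.cong h (W-η v) ⟩
    h ⟨$⟩ (s ⟨$⟩ (nW v , bW v))        ≈⟨ hom (nW v , bW v) ⟩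
    aC ⟨$⟩ (nW v , (h ∘ₛ bW v))        ≈⟨ Func.cong aC (Setoid.refl (P C) {nW v , (h ∘ₛ bW v)}) ⟩
    aC ⟨$⟩ (nW v , ((h ∘ₛ m v) ∘ₛ e v)) ∎
    where
    open import Relation.Binary.Reasoning.Setoid C
    v : W₀
    v = bW₀ w c

lemma3p14 : (A : Setoid 0ℓ 0ℓ) (B : SetoidFamily A)
    (C : Setoid 0ℓ 0ℓ) (aC : Func (Construction.P A B C) C)
    (h : Func (Construction.W A B) C) →
    (h ∘ₛ Construction.s A B) ≈ₛ (aC ∘ₛ Construction.Pmap A B h) →
    (w : Setoid.Carrier (Construction.W A B)) →
    Construction.RecDef A B C aC w (h ∘ₛ Construction.m A B w)
lemma3p14 A B C aC h hom =
  unfolding⇒recDef (morphism⇒unfolds hom)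
  where open Restrictions A B C aC h
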